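{- Let $R\subseteq\mathbb N$ be such that for all $s,u,v\in\mathbb N$, all $\bar a_0\in\{0,1\}^s\setminus\{\bar0\}$, $\bar a_1,\dots,\bar a_u\in\mathbb N^s$ and all $c_1,\dots,c_u\in\mathbb N$ with $(\bar a_0,0)\ne(\bar a_i,c_i)$ for all $i\in\{1,\dots,u\}$, and with $c_0:=0$, there exist $\bar x,\bar y\in(v+\mathbb N)^s$ such that: $\bar a_i^{\top}\bar x-c_i\in R$ for all $i\in\{0,\dots,u\}$ with $\bar a_i\ne\bar0$; $\bar a_0^{\top}\bar y-c_0\notin R$; and $\bar a_i^{\top}\bar y-c_i\in R$ for all $i\in\{1,\dots,u\}$ with $\bar a_i\ne\bar0$. Then $R$ is rich.
   Context: For $s$-dimensional vectors, $\bar a^{\top}\bar x=\sum_{j=1}^sa_jx_j$; $v+\mathbb N=\{v,v+1,\dots\}$. A set $R\subseteq\mathbb N$ is rich if for all $s,u,v\in\mathbb N$, all $\bar a_0\in\{0,1\}^s\setminus\{\bar0\}$, $\bar a_1,\dots,\bar a_u\in\mathbb N^s$ and all $c_1,\dots,c_u\in\mathbb N$ with $(\bar a_0,0)\ne(\bar a_i,c_i)$ for all $i\in\{1,\dots,u\}$, there exist $\bar x,\bar y\in(v+\mathbb N)^s$ such that $\bar a_0^{\top}\bar x\in R\iff\bar a_0^{\top}\bar y\notin R$, and $\bar a_i^{\top}\bar x-c_i\in R\iff\bar a_i^{\top}\bar y-c_i\in R$ for all $i\in\{1,\dots,u\}$. -}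

module Defs where

open import Level using (0ℓ)
open import Data.Nat using (ℕ; _+_; _*_; _∸_; _≤_)
open import Data.Fin using (Fin)
open import Data.Vec using (Vec; zipWith; replicate; lookup)
open import Data.Vec.Relation.Unary.All using (All)
open import Data.Product using (_×_; Σ; ∃)
open import Relation.Nullary using (¬_)
open import Relation.Unary using (Pred; _∈_; _∉_)
open import Relation.Binary.PropositionalEquality using (_≡_; _≢_)
import Data.Vec as V

dot : ∀ {s} → Vec ℕ s → Vec ℕ s → ℕ
dot a x = V.sum (zipWith _*_ a x)

-- "z − c ∈ R" for natural z, c and R ⊆ ℕ, where z − c is the integer difference:
-- it lies in R ⊆ ℕ iff it is nonnegative (c ≤ z) and the natural number z ∸ c is in R.
_−_∈ᵣ_ : ℕ → ℕ → Pred ℕ 0ℓ → Set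
z − c ∈ᵣ R = c ≤ z × R (z ∸ c)

Is01NonZero : ∀ {s} → Vec ℕ s → Set
Is01NonZero {s} a = All (_≤ 1) a × a ≢ replicate s 0

AllAbove : ∀ {s} → ℕ → Vec ℕ s → Set
AllAbove v x = All (v ≤_) x

Rich : Pred ℕ 0ℓ → Set
Rich R =
  ∀ (s u v : ℕ) (a₀ : Vec ℕ s) (a : Fin u → Vec ℕ s) (c : Fin u → ℕ) →
  Is01NonZero a₀ →
  (∀ i → ¬ (a₀ ≡ a i × 0 ≡ c i)) →
  Σ (Vec ℕ s) λ x → Σ (Vec ℕ s) λ y →
    AllAbove v x × AllAbove v y ×
    ((dot a₀ x ∈ R → dot a₀ y ∉ R) × (dot a₀ y ∉ R → dot a₀ x ∈ R)) ×
    (∀ i → ((dot (a i) x − c i ∈ᵣ R) → (dot (a i) y − c i ∈ᵣ R)) ×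
           ((dot (a i) y − c i ∈ᵣ R) → (dot (a i) x − c i ∈ᵣ R)))

Hyp36 : Pred ℕ 0ℓ → Set
Hyp36 R =
  ∀ (s u v : ℕ) (a₀ : Vec ℕ s) (a : Fin u → Vec ℕ s) (c : Fin u → ℕ) →
  Is01NonZero a₀ →
  (∀ i → ¬ (a₀ ≡ a i × 0 ≡ c i)) →
  Σ (Vec ℕ s) λ x → Σ (Vec ℕ s) λ y →
    AllAbove v x × AllAbove v y ×
    (dot a₀ x − 0 ∈ᵣ R) ×
    (∀ i → a i ≢ replicate s 0 → dot (a i) x − c i ∈ᵣ R) ×
    ¬ (dot a₀ y − 0 ∈ᵣ R) ×
    (∀ i → a i ≢ replicate s 0 → dot (a i) y − c i ∈ᵣ R)

module Submission where

open import Defs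
open import Level using (0ℓ)
open import Data.Nat using (ℕ; z≤n)
open import Data.Nat.Properties using (_≟_)
open import Data.Vec using (Vec; []; _∷_; replicate)
open import Data.Vec.Properties using (≡-dec)
open import Data.Product using (_×_; _,_)
open import Function using (id; const)
open import Relation.Nullary using (yes; no)
open import Relation.Unary using (Pred)
open import Relation.Binary.PropositionalEquality using (_≡_; _≢_; refl)

-- The hypothesis makes both sides of every nonzero row condition true, so they agree;
-- a zero row sees the same number 0 − cᵢ at x̄ and ȳ.

dot-zeroˡ : ∀ {s} (x : Vec ℕ s) → dot (replicate s 0) x ≡ 0
dot-zeroˡ []       = refl
dot-zeroˡ (_ ∷ xs) = dot-zeroˡ xs

row-agrees : ∀ {s} (R : Pred ℕ 0ℓ) (x y b : Vec ℕ s) (c : ℕ) →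
             (b ≢ replicate s 0 → dot b x − c ∈ᵣ R) →
             (b ≢ replicate s 0 → dot b y − c ∈ᵣ R) →
             ((dot b x − c ∈ᵣ R) → (dot b y − c ∈ᵣ R)) ×
             ((dot b y − c ∈ᵣ R) → (dot b x − c ∈ᵣ R))
row-agrees R x y b c hx hy with ≡-dec _≟_ b (replicate _ 0)
... | no b≢0   = const (hy b≢0) , const (hx b≢0)
... | yes refl rewrite dot-zeroˡ x | dot-zeroˡ y = id , id

lemma36 : (R : Pred ℕ 0ℓ) → Hyp36 R → Rich R
lemma36 R hyp s u v a₀ a c a₀-01 a₀-new
  with hyp s u v a₀ a c a₀-01 a₀-new
... | x , y , x≥v , y≥v , (_ , a₀x∈R) , rows-x , a₀y∉R , rows-y =
  x , y , x≥v , y≥v ,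
  ((λ _ a₀y∈R → a₀y∉R (z≤n , a₀y∈R)) , const a₀x∈R) ,
  λ i → row-agrees R x y (a i) (c i) (rows-x i) (rows-y i)
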